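{- Let $k\ge 3$, $w\in\Sigma^n$, and let $u$ be a maximum-length plateau-$k$-rollercoaster that is a subsequence of $w$. Then there exists exactly one path $(v_{i_1},v_{i_2},\dots,v_{i_{|u|}})$ in $\mathrm{NEG}(w)$ such that $u=w[i_1]w[i_2]\cdots w[i_{|u|}]$.
   Context: Words are over the ordered alphabet $\Sigma=\{1,\dots,\sigma\}$. A factor $u=w[i,j]$ of $w\in\Sigma^n$ is a plateau-run with orientation $\uparrow$ if $u[\ell]\le u[\ell+1]$ for all $\ell$, and orientation $\downarrow$ if $u[\ell]\ge u[\ell+1]$ for all $\ell$; an increasing plateau-run $w[i,j]$ is maximal if ($i=1$ or $w[i-1]>w[i]$) and ($j=n$ or $w[j]>w[j+1]$), and analogously with reversed inequalities for decreasing runs. A plateau-run is a plateau-$k$-run if it contains at least $k$ distinct letters; a word is a plateau-$k$-rollercoaster if every maximal plateau-run in it is a plateau-$k$-run. $\mathrm{NEG}(w)$ is the directed edge-labelled graph with vertices $v_1,\dots,v_n$, where for $1\le i<j\le n$ there is an edge $(v_i,v_j)$ labelled $\uparrow$ if $w[i]<w[j]$ and every $j'\in[i+1,j-1]$ satisfies $w[j']<w[i]$ or $w[j']>w[j]$; labelled $\rightarrow$ if $w[i]=w[j]$ and $i$ is the largest index smaller than $j$ with $w[i]=w[j]$; labelled $\downarrow$ if $w[i]>w[j]$ and every $j'\in[i+1,j-1]$ satisfies $w[j']>w[i]$ or $w[j']<w[j]$; and no edge otherwise. -}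

module Defs where

open import Data.Nat using (ℕ; zero; suc)
open import Data.Fin using (Fin; toℕ; _<_; _≤_)
open import Data.List using (List; []; _∷_; length; lookup)
open import Data.Product using (Σ; ∃; _×_; _,_)
open import Data.Sum using (_⊎_)
open import Relation.Binary.PropositionalEquality using (_≡_; _≢_)
open import Relation.Nullary using (¬_)
open import Function.Base using (_∘_)
open import Function.Definitions using (Injective)

-- Words over the ordered alphabet Σ = {1,…,σ} are represented as lists over
-- Fin σ (letter c ∈ {1..σ} is encoded as c-1; the order is preserved).
-- Positions in a word x are 0-based elements of Fin (length x);
-- x[a] is written  lookup x a.

Word : ℕ → Set
Word σ = List (Fin σ)

module _ {σ : ℕ} (x : Word σ) where

  Pos : Set
  Pos = Fin (length x)

  Succ : Pos → Pos → Set
  Succ a b = toℕ b ≡ suc (toℕ a)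

  IncRun : Pos → Pos → Set
  IncRun i j = i ≤ j × (∀ a b → i ≤ a → b ≤ j → Succ a b → lookup x a ≤ lookup x b)

  DecRun : Pos → Pos → Set
  DecRun i j = i ≤ j × (∀ a b → i ≤ a → b ≤ j → Succ a b → lookup x b ≤ lookup x a)

  PlateauRun : Pos → Pos → Set
  PlateauRun i j = IncRun i j ⊎ DecRun i j

  -- maximality as in the paper:
  -- increasing: (i = first or x[i-1] > x[i]) and (j = last or x[j] > x[j+1])
  MaxIncRun : Pos → Pos → Set
  MaxIncRun i j = IncRun i j
                × (∀ a → Succ a i → lookup x i < lookup x a)
                × (∀ b → Succ j b → lookup x b < lookup x j)

  MaxDecRun : Pos → Pos → Set
  MaxDecRun i j = DecRun i j
                × (∀ a → Succ a i → lookup x a < lookup x i)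
                × (∀ b → Succ j b → lookup x j < lookup x b)

  ProperFactorOf : Pos → Pos → Pos → Pos → Set
  ProperFactorOf i j i' j' = i' ≤ i × j ≤ j' × (i' < i ⊎ j < j')

  -- A maximal plateau-run: maximal in its own
  -- orientation (paper's condition) and not a proper factor of a plateau-run
  -- of the other orientation (this only discards constant factors such as
  -- the "22" inside the increasing run "1223").
  MaximalPlateauRun : Pos → Pos → Set
  MaximalPlateauRun i j =
    (MaxIncRun i j ⊎ MaxDecRun i j)
    × ¬ (Σ Pos λ i' → Σ Pos λ j' → PlateauRun i' j' × ProperFactorOf i j i' j')

  AtLeastDistinct : ℕ → Pos → Pos → Set
  AtLeastDistinct k i j =
    Σ (Fin k → Pos) λ f → (∀ t → i ≤ f t × f t ≤ j) × Injective _≡_ _≡_ (lookup x ∘ f)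

PlateauRollercoaster : {σ : ℕ} → ℕ → Word σ → Set
PlateauRollercoaster k x =
  ∀ i j → MaximalPlateauRun x i j → AtLeastDistinct x k i j

data Label : Set where
  up right down : Label

module _ {σ : ℕ} (w : Word σ) where

  Between : Pos w → Pos w → Pos w → Set
  Between i j' j = i < j' × j' < j

  NEGEdgeLabelled : Label → Pos w → Pos w → Set
  NEGEdgeLabelled up i j =
    i < j × lookup w i < lookup w j
    × (∀ j' → Between i j' j → lookup w j' < lookup w i ⊎ lookup w j < lookup w j')
  NEGEdgeLabelled right i j =
    i < j × lookup w i ≡ lookup w j
    × (∀ j' → Between i j' j → lookup w j' ≢ lookup w j)
  NEGEdgeLabelled down i j =
    i < j × lookup w j < lookup w i
    × (∀ j' → Between i j' j → lookup w i < lookup w j' ⊎ lookup w j' < lookup w j)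

  NEGEdge : Pos w → Pos w → Set
  NEGEdge i j = ∃ λ ℓ → NEGEdgeLabelled ℓ i j

  data IsPath : List (Pos w) → Set where
    empty  : IsPath []
    single : ∀ v → IsPath (v ∷ [])
    step   : ∀ {a b vs} → NEGEdge a b → IsPath (b ∷ vs) → IsPath (a ∷ b ∷ vs)

-- Fix the positions of an occurrence of u in w. The heart of the matter is that inserting a
-- letter c between two adjacent letters a, b of a plateau-k-rollercoaster, with c weakly between
-- a and b, gives again a plateau-k-rollercoaster (c = a doubles a letter). This is seen through
-- the characterisation "every monotone factor lies in a monotone factor with k distinct letters",
-- which transfers along the index map of the insertion.
-- By maximality of u, no position strictly between two consecutive positions i < j of u carries
-- a letter weakly between w[i] and w[j]; that is exactly what makes (v_i, v_j) an edge of NEG(w),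
-- so the positions form a path. Conversely an edge (v_i, v_j) skips no occurrence of w[j], so a
-- path spelling u is determined by its first vertex; two first vertices x < y are impossible,
-- since prepending w[x] to the path from y would spell the longer rollercoaster w[x] u.
module Submission where

open import Defs
open import Data.Empty using (⊥; ⊥-elim)
open import Data.Fin as Fin using (Fin; toℕ; fromℕ<)
import Data.Fin.Properties as Finₚ
open import Data.List using (List; []; _∷_; length; lookup; map; _++_; [_])
open import Data.List.Properties using (++-assoc; map-++; map-∘; length-map; length-++; ∷-injective)
open import Data.List.Relation.Binary.Sublist.Propositional using (_⊆_; []; _∷_; _∷ʳ_; minimum)
open import Data.List.Relation.Unary.Linked as Linked using (Linked; []; [-]; _∷_)
import Data.List.Relation.Unary.Linked.Properties as Linkedₚ
open import Data.Maybe using (Maybe; just; nothing)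
open import Data.Maybe.Properties using (just-injective)
open import Data.Nat as ℕ using (ℕ; zero; suc; _≤_; _<_; z≤n; s≤s; s≤s⁻¹; _∸_; _+_)
open import Data.Nat.Induction using (<-wellFounded)
open import Data.Nat.Properties
open import Data.Product using (Σ; ∃; ∃₂; _×_; _,_; proj₁; proj₂)
open import Data.Sum using (_⊎_; inj₁; inj₂)
open import Function.Base using (_∘_)
open import Function.Definitions using (Injective)
open import Induction.WellFounded using (Acc; acc)
open import Relation.Binary.Core using (Rel; _Preserves_⟶_)
open import Relation.Binary.Definitions using (tri<; tri≈; tri>)
open import Relation.Binary.PropositionalEquality hiding ([_])
open import Relation.Nullary using (¬_; Dec; yes; no; contradiction)
open import Relation.Nullary.Decidable using (_×-dec_; _⊎-dec_; _→-dec_)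

data Orientation : Set where
  ↑ ↓ : Orientation

module _ {σ : ℕ} where

  Ordered : Orientation → Fin σ → Fin σ → Set
  Ordered ↑ p q = p Fin.≤ q
  Ordered ↓ p q = q Fin.≤ p

  StrictlyOrdered : Orientation → Fin σ → Fin σ → Set
  StrictlyOrdered ↑ p q = p Fin.< q
  StrictlyOrdered ↓ p q = q Fin.< p

  WeaklyBetween : Fin σ → Fin σ → Fin σ → Set
  WeaklyBetween a c b = ∃ λ o → Ordered o a c × Ordered o c b

  Ordered-refl : ∀ o {p} → Ordered o p p
  Ordered-refl ↑ = ≤-refl
  Ordered-refl ↓ = ≤-refl

  Ordered? : ∀ o p q → Dec (Ordered o p q)
  Ordered? ↑ p q = p Finₚ.≤? q
  Ordered? ↓ p q = q Finₚ.≤? p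

  StrictlyOrdered⇒Ordered : ∀ {o p q} → StrictlyOrdered o p q → Ordered o p q
  StrictlyOrdered⇒Ordered {↑} = <⇒≤
  StrictlyOrdered⇒Ordered {↓} = <⇒≤

  StrictlyOrdered-trans : ∀ {o p q r} →
                          StrictlyOrdered o p q → StrictlyOrdered o q r → StrictlyOrdered o p r
  StrictlyOrdered-trans {↑} p<q q<r = <-trans p<q q<r
  StrictlyOrdered-trans {↓} q<p r<q = <-trans r<q q<p

  Ordered∧≢⇒StrictlyOrdered : ∀ {o p q} → Ordered o p q → p ≢ q → StrictlyOrdered o p q
  Ordered∧≢⇒StrictlyOrdered {↑} p≤q p≢q = ≤∧≢⇒< p≤q (p≢q ∘ Finₚ.toℕ-injective)
  Ordered∧≢⇒StrictlyOrdered {↓} q≤p p≢q = ≤∧≢⇒< q≤p (p≢q ∘ sym ∘ Finₚ.toℕ-injective)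

  StrictlyOrdered-orientation : ∀ {o o′ p q} → StrictlyOrdered o p q → Ordered o′ p q → o′ ≡ o
  StrictlyOrdered-orientation {↑} {↑} _   _   = refl
  StrictlyOrdered-orientation {↑} {↓} p<q q≤p = contradiction q≤p (<⇒≱ p<q)
  StrictlyOrdered-orientation {↓} {↑} q<p p≤q = contradiction p≤q (<⇒≱ q<p)
  StrictlyOrdered-orientation {↓} {↓} _   _   = refl

module _ {A : Set} where

  _‼_ : List A → ℕ → Maybe A
  []       ‼ _     = nothing
  (x ∷ xs) ‼ zero  = just x
  (x ∷ xs) ‼ suc s = xs ‼ s

  ‼-lookup : ∀ (xs : List A) i → xs ‼ toℕ i ≡ just (lookup xs i)
  ‼-lookup (x ∷ xs) Fin.zero    = refl
  ‼-lookup (x ∷ xs) (Fin.suc i) = ‼-lookup xs i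

  ‼-just⇒< : ∀ (xs : List A) {s p} → xs ‼ s ≡ just p → s < length xs
  ‼-just⇒< (x ∷ xs) {zero}  _ = s≤s z≤n
  ‼-just⇒< (x ∷ xs) {suc s} e = s≤s (‼-just⇒< xs e)

  <⇒‼-just : ∀ (xs : List A) {s} → s < length xs → ∃ λ p → xs ‼ s ≡ just p
  <⇒‼-just (x ∷ xs) {zero}  _         = x , refl
  <⇒‼-just (x ∷ xs) {suc s} (s≤s s<n) = <⇒‼-just xs s<n

  ‼-agree-< : ∀ (xs ys : List A) {s t} → ys ‼ t ≡ xs ‼ s → s < length xs → t < length ys
  ‼-agree-< xs ys e s<n = ‼-just⇒< ys (trans e (proj₂ (<⇒‼-just xs s<n)))

  ‼-++ʳ : ∀ (xs ys : List A) t → (xs ++ ys) ‼ (t + length xs) ≡ ys ‼ t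
  ‼-++ʳ []       ys t = cong (ys ‼_) (+-identityʳ t)
  ‼-++ʳ (x ∷ xs) ys t = trans (cong ((x ∷ xs ++ ys) ‼_) (+-suc t (length xs))) (‼-++ʳ xs ys t)

-- The ℕ-analogue of Fin.punchIn: the increasing bijection ℕ → ℕ ∖ {n}.
skip : ℕ → ℕ → ℕ
skip zero    s       = suc s
skip (suc n) zero    = zero
skip (suc n) (suc s) = suc (skip n s)

skip-< : ∀ {n s} → s < n → skip n s ≡ s
skip-< {suc n} {zero}  _         = refl
skip-< {suc n} {suc s} (s≤s s<n) = cong suc (skip-< s<n)

skip-≥ : ∀ {n s} → n ≤ s → skip n s ≡ suc s
skip-≥ {zero}          _         = refl
skip-≥ {suc n} {suc s} (s≤s n≤s) = cong suc (skip-≥ n≤s)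

skip-mono : ∀ n → skip n Preserves _≤_ ⟶ _≤_
skip-mono zero    s≤t       = s≤s s≤t
skip-mono (suc n) z≤n       = z≤n
skip-mono (suc n) (s≤s s≤t) = s≤s (skip-mono n s≤t)

skip-suc≤skip : ∀ n s → skip (suc n) s ≤ skip n s
skip-suc≤skip zero    zero    = z≤n
skip-suc≤skip zero    (suc s) = ≤-refl
skip-suc≤skip (suc n) zero    = z≤n
skip-suc≤skip (suc n) (suc s) = s≤s (skip-suc≤skip n s)

≤-skip : ∀ n s → s ≤ skip n s
≤-skip zero    s       = n≤1+n s
≤-skip (suc n) zero    = z≤n
≤-skip (suc n) (suc s) = s≤s (≤-skip n s)

skip-≤-suc : ∀ n s → skip n s ≤ suc s
skip-≤-suc zero    s       = ≤-refl
skip-≤-suc (suc n) zero    = z≤n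
skip-≤-suc (suc n) (suc s) = s≤s (skip-≤-suc n s)

‼-skip : ∀ {A : Set} (xs : List A) a c ys s →
         (xs ++ a ∷ c ∷ ys) ‼ skip (suc (length xs)) s ≡ (xs ++ a ∷ ys) ‼ s
‼-skip []       a c ys zero    = refl
‼-skip []       a c ys (suc s) = refl
‼-skip (x ∷ xs) a c ys zero    = refl
‼-skip (x ∷ xs) a c ys (suc s) = ‼-skip xs a c ys s

module _ {σ : ℕ} where

  Step : Orientation → Word σ → ℕ → Set
  Step o x s = ∀ {p q} → x ‼ s ≡ just p → x ‼ suc s ≡ just q → Ordered o p q

  -- Unlike Pos x = Fin (length x), ℕ positions survive inserting a letter into x.
  record Monotone (o : Orientation) (x : Word σ) (i j : ℕ) : Set where
    constructor monotone
    field
      start≤end  : i ≤ j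
      end<length : j < length x
      steps      : ∀ {s} → i ≤ s → s < j → Step o x s

  open Monotone public

  Step-at : ∀ {o x s p q} → x ‼ s ≡ just p → x ‼ suc s ≡ just q → Ordered o p q → Step o x s
  Step-at {o} e₁ e₂ p≤q f₁ f₂ =
    subst₂ (Ordered o) (just-injective (trans (sym e₁) f₁)) (just-injective (trans (sym e₂) f₂)) p≤q

  Step-transport : ∀ {o x y s t} → y ‼ t ≡ x ‼ s → y ‼ suc t ≡ x ‼ suc s →
                   Step o x s → Step o y t
  Step-transport e₁ e₂ st f₁ f₂ = st (trans (sym e₁) f₁) (trans (sym e₂) f₂)

  Monotone-point : ∀ {o x i} → i < length x → Monotone o x i i
  Monotone-point i<n = monotone ≤-refl i<n λ i≤s s<i → contradiction (≤-<-trans i≤s s<i) (n≮n _)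

  Monotone-step : ∀ {o x s} → Step o x s → suc s < length x → Monotone o x s (suc s)
  Monotone-step {o} {x} {s} st 1+s<n = monotone (n≤1+n s) 1+s<n λ s≤t t<1+s →
    subst (Step o x) (≤-antisym s≤t (s≤s⁻¹ t<1+s)) st

  Monotone-join : ∀ {o x i j l} → Monotone o x i j → Monotone o x j l → Monotone o x i l
  Monotone-join {o} {x} {i} {j} {l} (monotone i≤j _ before) (monotone j≤l l<n after) =
    monotone (≤-trans i≤j j≤l) l<n joined
    where
      joined : ∀ {s} → i ≤ s → s < l → Step o x s
      joined {s} i≤s s<l with s ℕ.<? j
      ... | yes s<j = before i≤s s<j
      ... | no  s≮j = after (≮⇒≥ s≮j) s<l

  Monotone-restrict : ∀ {o x i j i′ j′} → i ≤ i′ → j′ ≤ j → i′ ≤ j′ →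
                      Monotone o x i j → Monotone o x i′ j′
  Monotone-restrict i≤i′ j′≤j i′≤j′ (monotone _ j<n steps) =
    monotone i′≤j′ (≤-<-trans j′≤j j<n) λ i′≤s s<j′ →
      steps (≤-trans i≤i′ i′≤s) (<-≤-trans s<j′ j′≤j)

  Monotone-agree : ∀ {o x y i j} → (∀ {s} → i ≤ s → s ≤ j → y ‼ s ≡ x ‼ s) →
                   Monotone o x i j → Monotone o y i j
  Monotone-agree {x = x} {y} e (monotone i≤j j<n steps) =
    monotone i≤j (‼-agree-< x y (e i≤j ≤-refl) j<n) λ i≤s s<j →
      Step-transport {x = x} {y} (e i≤s (<⇒≤ s<j)) (e (m≤n⇒m≤1+n i≤s) s<j) (steps i≤s s<j)

  Monotone-shift : ∀ {o x y i j} → (∀ {s} → i ≤ s → s ≤ j → y ‼ suc s ≡ x ‼ s) →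
                   Monotone o x i j → Monotone o y (suc i) (suc j)
  Monotone-shift {o} {x} {y} {i} {j} e (monotone i≤j j<n steps) =
    monotone (s≤s i≤j) (‼-agree-< x y (e i≤j ≤-refl) j<n) shifted
    where
      shifted : ∀ {t} → suc i ≤ t → t < suc j → Step o y t
      shifted {suc s} (s≤s i≤s) (s≤s s<j) =
        Step-transport {x = x} {y} (e i≤s (<⇒≤ s<j)) (e (m≤n⇒m≤1+n i≤s) s<j) (steps i≤s s<j)

  Monotone-unshift : ∀ {o x y i j} → (∀ {s} → i ≤ s → s ≤ j → y ‼ suc s ≡ x ‼ s) →
                     Monotone o y (suc i) (suc j) → Monotone o x i j
  Monotone-unshift {x = x} {y} e (monotone 1+i≤1+j 1+j<n steps) =
    monotone i≤j (‼-agree-< y x (sym (e i≤j ≤-refl)) 1+j<n) λ i≤s s<j →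
      Step-transport {x = y} {x} (sym (e i≤s (<⇒≤ s<j))) (sym (e (m≤n⇒m≤1+n i≤s) s<j))
        (steps (s≤s i≤s) (s≤s s<j))
    where i≤j = s≤s⁻¹ 1+i≤1+j

  Distinct : ℕ → Word σ → ℕ → ℕ → Set
  Distinct k x i j = Σ (Fin k → ℕ) λ f →
                     (∀ t → i ≤ f t × f t ≤ j) × Injective _≡_ _≡_ ((x ‼_) ∘ f)

  Distinct-widen : ∀ {k x i j i′ j′} → i ≤ i′ → j′ ≤ j → Distinct k x i′ j′ → Distinct k x i j
  Distinct-widen i≤i′ j′≤j (f , range , inj) =
    f , (λ t → ≤-trans i≤i′ (proj₁ (range t)) , ≤-trans (proj₂ (range t)) j′≤j) , inj

  InKRun : ℕ → Word σ → ℕ → ℕ → Set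
  InKRun k x i j = Σ Orientation λ o → Σ ℕ λ i′ → Σ ℕ λ j′ →
                   i′ ≤ i × j ≤ j′ × Monotone o x i′ j′ × Distinct k x i′ j′

  Covered : ℕ → Word σ → Set
  Covered k x = ∀ {o i j} → Monotone o x i j → InKRun k x i j

  -- [lo i, hi j] is the hull in v of the image of a run u[i..j]. A run of v lies in the hull of
  -- a run of u, which lies in a k-run of u, whose hull is a k-run of v.
  Covered-transfer :
    ∀ {k} {u v : Word σ} (lo hi : ℕ → ℕ) →
    lo Preserves _≤_ ⟶ _≤_ → hi Preserves _≤_ ⟶ _≤_ → (∀ s → lo s ≤ hi s) →
    (∀ s → v ‼ lo s ≡ u ‼ s) →
    (∀ {o i j} → Monotone o u i j → Monotone o v (lo i) (hi j)) →
    (∀ {o I J} → Monotone o v I J →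
       ∃₂ λ i j → lo i ≤ I × J ≤ hi j × ∃ λ o′ → Monotone o′ u i j) →
    Covered k u → Covered k v
  Covered-transfer lo hi lo-mono hi-mono lo≤hi v‼lo image preimage covered R
    with preimage R
  ... | i , j , lo-i≤I , J≤hi-j , _ , R° with covered R°
  ... | o , i′ , j′ , i′≤i , j≤j′ , R′ , (f , range , inj) =
    o , lo i′ , hi j′ , ≤-trans (lo-mono i′≤i) lo-i≤I , ≤-trans J≤hi-j (hi-mono j≤j′) , image R′ ,
    (lo ∘ f , range′ , λ e → inj (trans (sym (v‼lo _)) (trans e (v‼lo _))))
    where
      range′ : ∀ t → lo i′ ≤ lo (f t) × lo (f t) ≤ hi j′
      range′ t = lo-mono (proj₁ (range t)) , ≤-trans (lo≤hi (f t)) (hi-mono (proj₂ (range t)))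

-- Inserting a letter

module Insertion {σ : ℕ} (xs ys : Word σ) (a c : Fin σ) where

  u v : Word σ
  u = xs ++ a ∷ ys
  v = xs ++ a ∷ c ∷ ys

  m : ℕ
  m = length xs

  v‼skip : ∀ s → v ‼ skip (suc m) s ≡ u ‼ s
  v‼skip = ‼-skip xs a c ys

  v‼≤ : ∀ {s} → s ≤ m → v ‼ s ≡ u ‼ s
  v‼≤ {s} s≤m = trans (cong (v ‼_) (sym (skip-< (s≤s s≤m)))) (v‼skip s)

  v‼> : ∀ {s} → m < s → v ‼ suc s ≡ u ‼ s
  v‼> {s} m<s = trans (cong (v ‼_) (sym (skip-≥ m<s))) (v‼skip s)

  u‼m : u ‼ m ≡ just a
  u‼m = ‼-++ʳ xs (a ∷ ys) 0

  v‼m : v ‼ m ≡ just a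
  v‼m = ‼-++ʳ xs (a ∷ c ∷ ys) 0

  v‼1+m : v ‼ suc m ≡ just c
  v‼1+m = ‼-++ʳ xs (a ∷ c ∷ ys) 1

-- a occupies both m and m + 1 in v; hi = skip m stretches a run of u ending at m over both copies.
module Duplication {σ : ℕ} (xs ys : Word σ) (a : Fin σ) where

  open Insertion xs ys a a

  v‼≥ : ∀ {s} → m ≤ s → v ‼ suc s ≡ u ‼ s
  v‼≥ m≤s with m≤n⇒m<n∨m≡n m≤s
  ... | inj₁ m<s  = v‼> m<s
  ... | inj₂ refl = trans v‼1+m (sym u‼m)

  image : ∀ {o i j} → Monotone o u i j → Monotone o v (skip (suc m) i) (skip m j)
  image {o} {i} {j} R with j ℕ.<? m | i ℕ.≤? m
  ... | yes j<m | _
    rewrite skip-< {suc m} (s≤s (<⇒≤ (≤-<-trans (start≤end R) j<m))) | skip-< j<m =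
    Monotone-agree (λ _ s≤j → v‼≤ (≤-trans s≤j (<⇒≤ j<m))) R
  ... | no j≮m | yes i≤m rewrite skip-< {suc m} (s≤s i≤m) | skip-≥ (≮⇒≥ j≮m) =
    Monotone-join (Monotone-agree (λ _ s≤m → v‼≤ s≤m) (Monotone-restrict ≤-refl m≤j i≤m R))
      (Monotone-join (Monotone-step (Step-at {x = v} v‼m v‼1+m (Ordered-refl o)) (‼-just⇒< v v‼1+m))
        (Monotone-shift (λ m≤s _ → v‼≥ m≤s) (Monotone-restrict i≤m ≤-refl m≤j R)))
    where m≤j = ≮⇒≥ j≮m
  ... | no j≮m | no i≰m rewrite skip-≥ (≰⇒> i≰m) | skip-≥ (≮⇒≥ j≮m) =
    Monotone-shift (λ i≤s _ → v‼≥ (≤-trans (<⇒≤ (≰⇒> i≰m)) i≤s)) R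

  preimage : ∀ {o I J} → Monotone o v I J →
             ∃₂ λ i j → skip (suc m) i ≤ I × J ≤ skip m j × ∃ λ o′ → Monotone o′ u i j
  preimage {o} {I} {J} R with J ℕ.≤? m
  ... | yes J≤m =
    I , J , ≤-reflexive (skip-< (s≤s (≤-trans (start≤end R) J≤m))) , ≤-skip m J ,
    o , Monotone-agree (λ _ s≤J → sym (v‼≤ (≤-trans s≤J J≤m))) R
  preimage {J = zero} R | no J≰m = contradiction z≤n J≰m
  preimage {o} {I} {suc J′} R | no J≰m with I ℕ.≤? m
  ... | yes I≤m =
    I , J′ , ≤-reflexive (skip-< (s≤s I≤m)) , ≤-reflexive (sym (skip-≥ m≤J′)) ,
    o , Monotone-join
          (Monotone-agree (λ _ s≤m → sym (v‼≤ s≤m))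
            (Monotone-restrict ≤-refl (m≤n⇒m≤1+n m≤J′) I≤m R))
          (Monotone-unshift (λ m≤s _ → v‼≥ m≤s)
            (Monotone-restrict (m≤n⇒m≤1+n I≤m) ≤-refl (s≤s m≤J′) R))
    where m≤J′ = s≤s⁻¹ (≰⇒> J≰m)
  preimage {o} {suc I′} {suc J′} R | no J≰m | no I≰m =
    I′ , J′ , skip-≤-suc (suc m) I′ ,
    ≤-reflexive (sym (skip-≥ (≤-trans m≤I′ (s≤s⁻¹ (start≤end R))))) ,
    o , Monotone-unshift (λ I′≤s _ → v‼≥ (≤-trans m≤I′ I′≤s)) R
    where m≤I′ = s≤s⁻¹ (≰⇒> I≰m)
  preimage {I = zero} R | no J≰m | no I≰m = contradiction z≤n I≰m

  covered : ∀ {k} → Covered k u → Covered k v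
  covered = Covered-transfer (skip (suc m)) (skip m) (skip-mono (suc m)) (skip-mono m)
              (skip-suc≤skip m) v‼skip image preimage

module StrictInsertion {σ : ℕ} (xs ys : Word σ) {a b c : Fin σ} {o : Orientation}
                       (a<c : StrictlyOrdered o a c) (c<b : StrictlyOrdered o c b) where

  open Insertion xs (b ∷ ys) a c

  u‼1+m : u ‼ suc m ≡ just b
  u‼1+m = ‼-++ʳ xs (a ∷ b ∷ ys) 1

  v‼2+m : v ‼ suc (suc m) ≡ just b
  v‼2+m = trans (v‼> ≤-refl) u‼1+m

  a<b : StrictlyOrdered o a b
  a<b = StrictlyOrdered-trans a<c c<b

  ordered-ab-from-ac : ∀ {o′} → Ordered o′ a c → Ordered o′ a b
  ordered-ab-from-ac a≤c with StrictlyOrdered-orientation a<c a≤c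
  ... | refl = StrictlyOrdered⇒Ordered a<b

  ordered-ab-from-cb : ∀ {o′} → Ordered o′ c b → Ordered o′ a b
  ordered-ab-from-cb c≤b with StrictlyOrdered-orientation c<b c≤b
  ... | refl = StrictlyOrdered⇒Ordered a<b

  Monotone-acb : ∀ {o′} → Ordered o′ a b → Monotone o′ v m (suc (suc m))
  Monotone-acb a≤b with StrictlyOrdered-orientation a<b a≤b
  ... | refl = Monotone-join
    (Monotone-step (Step-at {x = v} v‼m v‼1+m (StrictlyOrdered⇒Ordered a<c)) (‼-just⇒< v v‼1+m))
    (Monotone-step (Step-at {x = v} v‼1+m v‼2+m (StrictlyOrdered⇒Ordered c<b)) (‼-just⇒< v v‼2+m))

  image : ∀ {o′ i j} → Monotone o′ u i j → Monotone o′ v (skip (suc m) i) (skip (suc m) j)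
  image {o′} {i} {j} R with j ℕ.≤? m | i ℕ.≤? m
  ... | yes j≤m | _
    rewrite skip-< {suc m} (s≤s (≤-trans (start≤end R) j≤m)) | skip-< {suc m} (s≤s j≤m) =
    Monotone-agree (λ _ s≤j → v‼≤ (≤-trans s≤j j≤m)) R
  ... | no j≰m | yes i≤m rewrite skip-< {suc m} (s≤s i≤m) | skip-≥ {suc m} (≰⇒> j≰m) =
    Monotone-join (Monotone-agree (λ _ s≤m → v‼≤ s≤m) (Monotone-restrict ≤-refl (<⇒≤ m<j) i≤m R))
      (Monotone-join (Monotone-acb (steps R i≤m m<j u‼m u‼1+m))
        (Monotone-shift (λ m<s _ → v‼> m<s) (Monotone-restrict (m≤n⇒m≤1+n i≤m) ≤-refl m<j R)))
    where m<j = ≰⇒> j≰m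
  ... | no j≰m | no i≰m rewrite skip-≥ {suc m} (≰⇒> i≰m) | skip-≥ {suc m} (≰⇒> j≰m) =
    Monotone-shift (λ i≤s _ → v‼> (<-≤-trans (≰⇒> i≰m) i≤s)) R

  prefix : ∀ {o′ I J} → m < J → (I ≤ m → Monotone o′ v I J) →
           ∃ λ i → i ≤ m × i ≤ I × Monotone o′ u i m
  prefix {I = I} m<J R with I ℕ.≤? m
  ... | yes I≤m = I , I≤m , ≤-refl ,
    Monotone-agree (λ _ s≤m → sym (v‼≤ s≤m)) (Monotone-restrict ≤-refl (<⇒≤ m<J) I≤m (R I≤m))
  ... | no I≰m = m , ≤-refl , <⇒≤ (≰⇒> I≰m) , Monotone-point (‼-just⇒< u u‼m)

  suffix : ∀ {o′ I J} → I ≤ suc m → (suc (suc m) ≤ J → Monotone o′ v I J) →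
           ∃ λ j → suc m ≤ j × J ≤ suc j × Monotone o′ u (suc m) j
  suffix {J = J} I≤1+m R with suc (suc m) ℕ.≤? J
  suffix {J = suc J′} I≤1+m R | yes 2+m≤J = J′ , s≤s⁻¹ 2+m≤J , ≤-refl ,
    Monotone-unshift (λ m<s _ → v‼> m<s)
      (Monotone-restrict (m≤n⇒m≤1+n I≤1+m) ≤-refl 2+m≤J (R 2+m≤J))
  ... | no 2+m≰J = suc m , ≤-refl , <⇒≤ (≰⇒> 2+m≰J) , Monotone-point (‼-just⇒< u u‼1+m)

  across : ∀ {o′ I J} → I ≤ suc m → m < J → Ordered o′ a b →
           (I ≤ m → Monotone o′ v I J) → (suc (suc m) ≤ J → Monotone o′ v I J) →
           ∃₂ λ i j → skip (suc m) i ≤ I × J ≤ skip (suc m) j × ∃ λ o″ → Monotone o″ u i j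
  across {o′} I≤1+m m<J a≤b fromPrefix fromSuffix
    with prefix m<J fromPrefix | suffix I≤1+m fromSuffix
  ... | i , i≤m , i≤I , L | j , 1+m≤j , J≤1+j , R =
    i , j , ≤-trans (≤-reflexive (skip-< (s≤s i≤m))) i≤I ,
    ≤-trans J≤1+j (≤-reflexive (sym (skip-≥ 1+m≤j))) ,
    o′ , Monotone-join L
           (Monotone-join (Monotone-step (Step-at {x = u} u‼m u‼1+m a≤b) (‼-just⇒< u u‼1+m)) R)

  preimage : ∀ {o′ I J} → Monotone o′ v I J →
             ∃₂ λ i j → skip (suc m) i ≤ I × J ≤ skip (suc m) j × ∃ λ o″ → Monotone o″ u i j
  preimage {o′} {I} {J} R with J ℕ.≤? m | suc m ℕ.<? I
  ... | yes J≤m | _ =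
    I , J , ≤-reflexive (skip-< (s≤s (≤-trans (start≤end R) J≤m))) , ≤-skip (suc m) J ,
    o′ , Monotone-agree (λ _ s≤J → sym (v‼≤ (≤-trans s≤J J≤m))) R
  preimage {o′} {suc I′} {suc J′} R | no J≰m | yes 1+m<I =
    I′ , J′ , ≤-reflexive (skip-≥ m<I′) ,
    ≤-reflexive (sym (skip-≥ (≤-trans m<I′ (s≤s⁻¹ (start≤end R))))) ,
    o′ , Monotone-unshift (λ I′≤s _ → v‼> (≤-trans m<I′ I′≤s)) R
    where m<I′ = s≤s⁻¹ 1+m<I
  preimage {o′} {I} {J} R | no J≰m | no 1+m≮I with I ℕ.≤? m | suc (suc m) ℕ.≤? J
  ... | yes I≤m | _ =
    across I≤1+m m<J (ordered-ab-from-ac (steps R I≤m m<J v‼m v‼1+m)) (λ _ → R) (λ _ → R)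
    where I≤1+m = ≮⇒≥ 1+m≮I ; m<J = ≰⇒> J≰m
  ... | no _ | yes 2+m≤J =
    across I≤1+m m<J (ordered-ab-from-cb (steps R I≤1+m 2+m≤J v‼1+m v‼2+m)) (λ _ → R) (λ _ → R)
    where I≤1+m = ≮⇒≥ 1+m≮I ; m<J = ≰⇒> J≰m
  ... | no I≰m | no 2+m≰J =
    across (≮⇒≥ 1+m≮I) (≰⇒> J≰m) (StrictlyOrdered⇒Ordered a<b)
      (λ I≤m → contradiction I≤m I≰m) (λ 2+m≤J → contradiction 2+m≤J 2+m≰J)

  covered : ∀ {k} → Covered k u → Covered k v
  covered = Covered-transfer (skip (suc m)) (skip (suc m)) (skip-mono (suc m)) (skip-mono (suc m))
              (λ _ → ≤-refl) v‼skip image preimage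

-- Plateau-k-rollercoasters through k-runs

module _ {σ : ℕ} (x : Word σ) where

  position : ∀ {s} → s < length x → Σ (Pos x) λ i → toℕ i ≡ s
  position s<n = fromℕ< s<n , Finₚ.toℕ-fromℕ< s<n

  ‼-Succ : ∀ {a b} → Succ x a b → x ‼ suc (toℕ a) ≡ just (lookup x b)
  ‼-Succ {b = b} a→b = subst (λ t → x ‼ t ≡ just (lookup x b)) a→b (‼-lookup x b)

  -- Run ↑ and Run ↓ are IncRun x and DecRun x, definitionally.
  Run : Orientation → Pos x → Pos x → Set
  Run o i j = i Fin.≤ j ×
              (∀ a b → i Fin.≤ a → b Fin.≤ j → Succ x a b → Ordered o (lookup x a) (lookup x b))

  Run⇒PlateauRun : ∀ {o i j} → Run o i j → PlateauRun x i j
  Run⇒PlateauRun {↑} = inj₁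
  Run⇒PlateauRun {↓} = inj₂

  PlateauRun⇒Run : ∀ {i j} → PlateauRun x i j → ∃ λ o → Run o i j
  PlateauRun⇒Run (inj₁ r) = ↑ , r
  PlateauRun⇒Run (inj₂ r) = ↓ , r

  Run⇒Monotone : ∀ {o i j} → Run o i j → Monotone o x (toℕ i) (toℕ j)
  Run⇒Monotone {o} {i} {j} (i≤j , ordered) = monotone i≤j (Finₚ.toℕ<n j) steps′
    where
      steps′ : ∀ {s} → toℕ i ≤ s → s < toℕ j → Step o x s
      steps′ i≤s s<j
        with position (<-trans s<j (Finₚ.toℕ<n j)) | position (≤-<-trans s<j (Finₚ.toℕ<n j))
      ... | a , refl | b , b≡1+a =
        Step-at {x = x} (‼-lookup x a) (‼-Succ b≡1+a)
          (ordered a b i≤s (subst (_≤ toℕ j) (sym b≡1+a) s<j) b≡1+a)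

  Monotone⇒Run : ∀ {o i j} → Monotone o x (toℕ i) (toℕ j) → Run o i j
  Monotone⇒Run {j = j} (monotone i≤j _ steps) = i≤j , λ a b i≤a b≤j a→b →
    steps i≤a (subst (_≤ toℕ j) a→b b≤j) (‼-lookup x a) (‼-Succ a→b)

  Monotone-Succ : ∀ {o a b} → Succ x a b → Ordered o (lookup x a) (lookup x b) →
                  Monotone o x (toℕ a) (toℕ b)
  Monotone-Succ {o} {a} {b} a→b a≤b = subst (Monotone o x (toℕ a)) (sym a→b)
    (Monotone-step (Step-at {x = x} (‼-lookup x a) (‼-Succ a→b) a≤b)
      (subst (_< length x) a→b (Finₚ.toℕ<n b)))

  Run-extendˡ : ∀ {o a i j} → Succ x a i → Ordered o (lookup x a) (lookup x i) → Run o i j → Run o a j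
  Run-extendˡ a→i a≤i R = Monotone⇒Run (Monotone-join (Monotone-Succ a→i a≤i) (Run⇒Monotone R))

  Run-extendʳ : ∀ {o i j b} → Succ x j b → Ordered o (lookup x j) (lookup x b) → Run o i j → Run o i b
  Run-extendʳ j→b j≤b R = Monotone⇒Run (Monotone-join (Run⇒Monotone R) (Monotone-Succ j→b j≤b))

  AtLeastDistinct⇒Distinct : ∀ {k i j} → AtLeastDistinct x k i j → Distinct k x (toℕ i) (toℕ j)
  AtLeastDistinct⇒Distinct (f , range , inj) = toℕ ∘ f , range , λ e →
    inj (just-injective (trans (sym (‼-lookup x (f _))) (trans e (‼-lookup x (f _)))))

  Distinct⇒AtLeastDistinct : ∀ {k i j} → Distinct k x (toℕ i) (toℕ j) → AtLeastDistinct x k i j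
  Distinct⇒AtLeastDistinct {k} {i} {j} (f , range , inj) =
    g , range′ , λ e → inj (trans (‼-g _) (trans (cong just e) (sym (‼-g _))))
    where
      f<n : ∀ t → f t < length x
      f<n t = ≤-<-trans (proj₂ (range t)) (Finₚ.toℕ<n j)
      g : Fin k → Pos x
      g t = proj₁ (position (f<n t))
      toℕ-g : ∀ t → toℕ (g t) ≡ f t
      toℕ-g t = proj₂ (position (f<n t))
      ‼-g : ∀ t → x ‼ f t ≡ just (lookup x (g t))
      ‼-g t = trans (cong (x ‼_) (sym (toℕ-g t))) (‼-lookup x (g t))
      range′ : ∀ t → i Fin.≤ g t × g t Fin.≤ j
      range′ t = subst (toℕ i ≤_) (sym (toℕ-g t)) (proj₁ (range t)) ,
                 subst (_≤ toℕ j) (sym (toℕ-g t)) (proj₂ (range t))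

  Extendable : Pos x → Pos x → Set
  Extendable i j = Σ (Pos x) λ i′ → Σ (Pos x) λ j′ → PlateauRun x i′ j′ × ProperFactorOf x i j i′ j′

  Run? : ∀ o i j → Dec (Run o i j)
  Run? o i j = i Finₚ.≤? j ×-dec Finₚ.all? λ a → Finₚ.all? λ b →
    i Finₚ.≤? a →-dec b Finₚ.≤? j →-dec toℕ b ℕ.≟ suc (toℕ a) →-dec
    Ordered? o (lookup x a) (lookup x b)

  Extendable? : ∀ i j → Dec (Extendable i j)
  Extendable? i j = Finₚ.any? λ i′ → Finₚ.any? λ j′ →
    (Run? ↑ i′ j′ ⊎-dec Run? ↓ i′ j′) ×-dec
    i′ Finₚ.≤? i ×-dec j Finₚ.≤? j′ ×-dec (i′ Finₚ.<? i ⊎-dec j Finₚ.<? j′)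

  slack : Pos x → Pos x → ℕ
  slack i j = toℕ i + (length x ∸ toℕ j)

  slack-< : ∀ {i j i′ j′} → ProperFactorOf x i j i′ j′ → slack i′ j′ < slack i j
  slack-< (_ , j≤j′ , inj₁ i′<i) = +-mono-<-≤ i′<i (∸-monoʳ-≤ (length x) j≤j′)
  slack-< {j′ = j′} (i′≤i , _ , inj₂ j<j′) =
    +-mono-≤-< i′≤i (∸-monoʳ-< j<j′ (<⇒≤ (Finₚ.toℕ<n j′)))

  unextendableExtension : ∀ {i j} → PlateauRun x i j →
    Σ (Pos x) λ i′ → Σ (Pos x) λ j′ →
    i′ Fin.≤ i × j Fin.≤ j′ × PlateauRun x i′ j′ × ¬ Extendable i′ j′
  unextendableExtension = go (<-wellFounded _)
    where
      go : ∀ {i j} → Acc _<_ (slack i j) → PlateauRun x i j →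
           Σ (Pos x) λ i′ → Σ (Pos x) λ j′ →
           i′ Fin.≤ i × j Fin.≤ j′ × PlateauRun x i′ j′ × ¬ Extendable i′ j′
      go {i} {j} (acc smaller) r with Extendable? i j
      ... | no unext = i , j , ≤-refl , ≤-refl , r , unext
      ... | yes (i′ , j′ , r′ , proper@(i′≤i , j≤j′ , _)) with go (smaller (slack-< proper)) r′
      ...   | i″ , j″ , i″≤i′ , j′≤j″ , r″ , unext =
        i″ , j″ , ≤-trans i″≤i′ i′≤i , ≤-trans j≤j′ j′≤j″ , r″ , unext

  unextendable-ends : ∀ {o i j} → Run o i j → ¬ Extendable i j →
    (∀ a → Succ x a i → ¬ Ordered o (lookup x a) (lookup x i)) ×
    (∀ b → Succ x j b → ¬ Ordered o (lookup x j) (lookup x b))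
  unextendable-ends R unext =
    (λ a a→i a≤i → unext (a , _ , Run⇒PlateauRun (Run-extendˡ a→i a≤i R) ,
                           <⇒≤ (Succ⇒< a→i) , ≤-refl , inj₁ (Succ⇒< a→i))) ,
    (λ b j→b j≤b → unext (_ , b , Run⇒PlateauRun (Run-extendʳ j→b j≤b R) ,
                           ≤-refl , <⇒≤ (Succ⇒< j→b) , inj₂ (Succ⇒< j→b)))
    where
      Succ⇒< : ∀ {a b} → Succ x a b → a Fin.< b
      Succ⇒< a→b = ≤-reflexive (sym a→b)

  unextendable⇒maximal : ∀ {i j} → PlateauRun x i j → ¬ Extendable i j → MaximalPlateauRun x i j
  unextendable⇒maximal (inj₁ R) unext with unextendable-ends {↑} R unext
  ... | first , last =
    inj₁ (R , (λ a a→i → ≰⇒> (first a a→i)) , λ b j→b → ≰⇒> (last b j→b)) , unext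
  unextendable⇒maximal (inj₂ R) unext with unextendable-ends {↓} R unext
  ... | first , last =
    inj₂ (R , (λ a a→i → ≰⇒> (first a a→i)) , λ b j→b → ≰⇒> (last b j→b)) , unext

  maximal⇒PlateauRun : ∀ {i j} → MaximalPlateauRun x i j → PlateauRun x i j
  maximal⇒PlateauRun (inj₁ (R , _) , _) = inj₁ R
  maximal⇒PlateauRun (inj₂ (R , _) , _) = inj₂ R

  unextendable-tight : ∀ {o I J i j} → ¬ Extendable I J → Monotone o x i j →
                       i ≤ toℕ I → toℕ J ≤ j → toℕ I ≤ i × j ≤ toℕ J
  unextendable-tight unext R i≤I J≤j
    with position (≤-<-trans (start≤end R) (end<length R)) | position (end<length R)
  ... | I′ , refl | J′ , refl =
    ≮⇒≥ (λ I′<I → unext (I′ , J′ , Run⇒PlateauRun (Monotone⇒Run R) , i≤I , J≤j , inj₁ I′<I)) ,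
    ≮⇒≥ (λ J<J′ → unext (I′ , J′ , Run⇒PlateauRun (Monotone⇒Run R) , i≤I , J≤j , inj₂ J<J′))

module _ {σ : ℕ} {k : ℕ} {x : Word σ} where

  rollercoaster⇒covered : PlateauRollercoaster k x → Covered k x
  rollercoaster⇒covered rc R
    with position x (≤-<-trans (start≤end R) (end<length R)) | position x (end<length R)
  ... | I , refl | J , refl with unextendableExtension x (Run⇒PlateauRun x (Monotone⇒Run x R))
  ... | I′ , J′ , I′≤I , J≤J′ , r′ , unext with PlateauRun⇒Run x r′
  ... | o′ , R′ = o′ , toℕ I′ , toℕ J′ , I′≤I , J≤J′ , Run⇒Monotone x R′ ,
    AtLeastDistinct⇒Distinct x (rc I′ J′ (unextendable⇒maximal x r′ unext))

  covered⇒rollercoaster : Covered k x → PlateauRollercoaster k x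
  covered⇒rollercoaster covered I J max@(_ , unext)
    with PlateauRun⇒Run x (maximal⇒PlateauRun x max)
  ... | _ , R with covered (Run⇒Monotone x R)
  ... | _ , _ , _ , i≤I , J≤j , R′ , distinct with unextendable-tight x unext R′ i≤I J≤j
  ... | I≤i , j≤J = Distinct⇒AtLeastDistinct x (Distinct-widen {x = x} I≤i j≤J distinct)

module _ {σ : ℕ} {k : ℕ} where

  duplicate-rollercoaster : ∀ (xs ys : Word σ) a →
    PlateauRollercoaster k (xs ++ a ∷ ys) → PlateauRollercoaster k (xs ++ a ∷ a ∷ ys)
  duplicate-rollercoaster xs ys a =
    covered⇒rollercoaster ∘ Duplication.covered xs ys a ∘ rollercoaster⇒covered

  insert-rollercoaster : ∀ (xs ys : Word σ) {a b c} → WeaklyBetween a c b →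
    PlateauRollercoaster k (xs ++ a ∷ b ∷ ys) → PlateauRollercoaster k (xs ++ a ∷ c ∷ b ∷ ys)
  insert-rollercoaster xs ys {a} {b} {c} (o , a≤c , c≤b) rc with c Finₚ.≟ a | c Finₚ.≟ b
  ... | yes refl | _ = duplicate-rollercoaster xs (b ∷ ys) c rc
  ... | no _ | yes refl =
    subst (PlateauRollercoaster k) (++-assoc xs [ a ] (c ∷ c ∷ ys))
      (duplicate-rollercoaster (xs ++ [ a ]) ys c
        (subst (PlateauRollercoaster k) (sym (++-assoc xs [ a ] (c ∷ ys))) rc))
  ... | no c≢a | no c≢b =
    covered⇒rollercoaster
      (StrictInsertion.covered xs ys (Ordered∧≢⇒StrictlyOrdered a≤c (c≢a ∘ sym))
                                     (Ordered∧≢⇒StrictlyOrdered c≤b c≢b)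
                                     (rollercoaster⇒covered rc))

Linked-insert : ∀ {A : Set} {ℓ} {R : Rel A ℓ} as {x y z} bs →
                Linked R (as ++ x ∷ z ∷ bs) → R x y → R y z → Linked R (as ++ x ∷ y ∷ z ∷ bs)
Linked-insert []           bs (_ ∷ l) x~y y~z = x~y ∷ y~z ∷ l
Linked-insert (_ ∷ [])     bs (r ∷ l) x~y y~z = r ∷ Linked-insert [] bs l x~y y~z
Linked-insert (_ ∷ a ∷ as) bs (r ∷ l) x~y y~z = r ∷ Linked-insert (a ∷ as) bs l x~y y~z

map-≡⇒length-≡ : ∀ {A B : Set} (f : A → B) {xs ys} → map f xs ≡ map f ys → length xs ≡ length ys
map-≡⇒length-≡ f {xs} {ys} e = trans (sym (length-map f xs)) (trans (cong length e) (length-map f ys))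

module _ {n : ℕ} where

  Linked-suc⁺ : {ps : List (Fin n)} → Linked Fin._<_ ps → Linked Fin._<_ (map Fin.suc ps)
  Linked-suc⁺ l = Linkedₚ.map⁺ (Linked.map s≤s l)

  Linked-suc⁻ : {ps : List (Fin n)} → Linked Fin._<_ (map Fin.suc ps) → Linked Fin._<_ ps
  Linked-suc⁻ l = Linked.map s≤s⁻¹ (Linkedₚ.map⁻ l)

  Linked-zero∷suc : {ps : List (Fin n)} → Linked Fin._<_ ps → Linked Fin._<_ (Fin.zero ∷ map Fin.suc ps)
  Linked-zero∷suc []        = [-]
  Linked-zero∷suc [-]       = s≤s z≤n ∷ [-]
  Linked-zero∷suc (p<q ∷ l) = s≤s z≤n ∷ Linked-suc⁺ (p<q ∷ l)

  Linked-tail-suc : ∀ {p : Fin (suc n)} {ps} → Linked Fin._<_ (p ∷ ps) → ∃ λ qs → map Fin.suc qs ≡ ps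
  Linked-tail-suc [-] = [] , refl
  Linked-tail-suc {ps = Fin.suc q ∷ _} (_ ∷ l) with Linked-tail-suc l
  ... | qs , refl = q ∷ qs , refl

module _ {A : Set} where

  ⊆⇒positions : {u w : List A} → u ⊆ w →
                Σ (List (Fin (length w))) λ ps → Linked Fin._<_ ps × map (lookup w) ps ≡ u
  ⊆⇒positions [] = [] , [] , refl
  ⊆⇒positions (_ ∷ʳ u⊆w) with ⊆⇒positions u⊆w
  ... | ps , asc , spells = map Fin.suc ps , Linked-suc⁺ asc , trans (sym (map-∘ ps)) spells
  ⊆⇒positions (refl ∷ u⊆w) with ⊆⇒positions u⊆w
  ... | ps , asc , spells =
    Fin.zero ∷ map Fin.suc ps , Linked-zero∷suc asc , cong (_ ∷_) (trans (sym (map-∘ ps)) spells)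

  map-lookup-⊆ : {w : List A} {ps : List (Fin (length w))} → Linked Fin._<_ ps → map (lookup w) ps ⊆ w
  map-lookup-⊆ {[]}    {[]}            _   = []
  map-lookup-⊆ {y ∷ w} {[]}            _   = minimum _
  map-lookup-⊆ {y ∷ w} {Fin.zero ∷ _}  asc with Linked-tail-suc asc
  ... | qs , refl = refl ∷ subst (_⊆ w) (map-∘ qs) (map-lookup-⊆ (Linked-suc⁻ (Linked.tail asc)))
  map-lookup-⊆ {y ∷ w} {Fin.suc p ∷ _} asc with Linked-tail-suc asc
  ... | qs , refl =
    y ∷ʳ subst (_⊆ w) (map-∘ (p ∷ qs)) (map-lookup-⊆ (Linked-suc⁻ {ps = p ∷ qs} asc))

-- Paths in NEG(w)

module _ {σ : ℕ} (w : Word σ) where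

  private
    W : Pos w → Fin σ
    W = lookup w

  NEGEdge⇒< : ∀ {i j} → NEGEdge w i j → i Fin.< j
  NEGEdge⇒< (up    , i<j , _) = i<j
  NEGEdge⇒< (right , i<j , _) = i<j
  NEGEdge⇒< (down  , i<j , _) = i<j

  NEGEdge-fromGap : ∀ {i j} → i Fin.< j →
                    (∀ j′ → Between w i j′ j → ¬ WeaklyBetween (W i) (W j′) (W j)) → NEGEdge w i j
  NEGEdge-fromGap {i} {j} i<j gap with Finₚ.<-cmp (W i) (W j)
  ... | tri< wi<wj _ _ = up , i<j , wi<wj , outside
    where
      outside : ∀ j′ → Between w i j′ j → W j′ Fin.< W i ⊎ W j Fin.< W j′
      outside j′ btw with W j′ Finₚ.<? W i | W j Finₚ.<? W j′
      ... | yes below | _         = inj₁ below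
      ... | no _      | yes above = inj₂ above
      ... | no ≮i     | no ≯j     = ⊥-elim (gap j′ btw (↑ , ≮⇒≥ ≮i , ≮⇒≥ ≯j))
  ... | tri≈ _ wi≡wj _ = right , i<j , wi≡wj , λ j′ btw wj′≡wj →
    gap j′ btw (↑ , ≤-reflexive (cong toℕ (trans wi≡wj (sym wj′≡wj))) ,
                    ≤-reflexive (cong toℕ wj′≡wj))
  ... | tri> _ _ wj<wi = down , i<j , wj<wi , outside
    where
      outside : ∀ j′ → Between w i j′ j → W i Fin.< W j′ ⊎ W j′ Fin.< W j
      outside j′ btw with W i Finₚ.<? W j′ | W j′ Finₚ.<? W j
      ... | yes above | _         = inj₁ above
      ... | no _      | yes below = inj₂ below
      ... | no ≯i     | no ≮j     = ⊥-elim (gap j′ btw (↓ , ≮⇒≥ ≯i , ≮⇒≥ ≮j))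

  NEGEdge-nearest : ∀ {i j j′} → NEGEdge w i j → Between w i j′ j → W j′ ≢ W j
  NEGEdge-nearest (up , _ , wi<wj , outside) btw wj′≡wj with outside _ btw
  ... | inj₁ wj′<wi = <-asym wi<wj (subst (Fin._< W _) wj′≡wj wj′<wi)
  ... | inj₂ wj<wj′ = <-irrefl (cong toℕ (sym wj′≡wj)) wj<wj′
  NEGEdge-nearest (right , _ , _ , differ) btw = differ _ btw
  NEGEdge-nearest (down , _ , wj<wi , outside) btw wj′≡wj with outside _ btw
  ... | inj₁ wi<wj′ = <-asym wj<wi (subst (W _ Fin.<_) wj′≡wj wi<wj′)
  ... | inj₂ wj′<wj = <-irrefl (cong toℕ wj′≡wj) wj′<wj

  IsPath⇒Linked : ∀ {ps} → IsPath w ps → Linked Fin._<_ ps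
  IsPath⇒Linked empty      = []
  IsPath⇒Linked (single _) = [-]
  IsPath⇒Linked (step e p) = NEGEdge⇒< e ∷ IsPath⇒Linked p

  IsPath-determined : ∀ {x ps qs} → IsPath w (x ∷ ps) → IsPath w (x ∷ qs) →
                      map W ps ≡ map W qs → ps ≡ qs
  IsPath-determined (single _) (single _) _ = refl
  IsPath-determined (step {b = y} e p) (step {b = z} f q) spells
    with ∷-injective spells | Finₚ.<-cmp y z
  ... | _     , rest | tri≈ _ refl _ = cong (y ∷_) (IsPath-determined p q rest)
  ... | wy≡wz , _    | tri< y<z _ _ = ⊥-elim (NEGEdge-nearest f (NEGEdge⇒< e , y<z) wy≡wz)
  ... | wy≡wz , _    | tri> _ _ z<y = ⊥-elim (NEGEdge-nearest e (NEGEdge⇒< f , z<y) (sym wy≡wz))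

  Saturated : List (Pos w) → Set
  Saturated ps = ∀ as {i j} bs j′ → ps ≡ as ++ i ∷ j ∷ bs → Between w i j′ j →
                 ¬ WeaklyBetween (W i) (W j′) (W j)

  saturated⇒IsPath : ∀ {ps} → Linked Fin._<_ ps → Saturated ps → IsPath w ps
  saturated⇒IsPath []          _   = empty
  saturated⇒IsPath [-]         _   = single _
  saturated⇒IsPath {i ∷ _} (i<j ∷ asc) sat =
    step (NEGEdge-fromGap i<j (λ j′ → sat [] _ j′ refl))
         (saturated⇒IsPath asc λ as bs j′ e → sat (i ∷ as) bs j′ (cong (i ∷_) e))

-- Longest plateau-k-rollercoaster subsequences

module Longest {σ : ℕ} {k : ℕ} (w : Word σ) (n : ℕ)
  (longest : ∀ (u′ : Word σ) → u′ ⊆ w → PlateauRollercoaster k u′ → length u′ ≤ n) where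

  private
    W : Pos w → Fin σ
    W = lookup w

  no-longer : ∀ {ps} → Linked Fin._<_ ps → PlateauRollercoaster k (map W ps) → n < length ps → ⊥
  no-longer {ps} asc rc n<ps =
    <⇒≱ n<ps (subst (_≤ n) (length-map W ps) (longest _ (map-lookup-⊆ asc) rc))

  saturated : ∀ {ps} → Linked Fin._<_ ps → PlateauRollercoaster k (map W ps) → n ≤ length ps →
              Saturated w ps
  saturated asc rc n≤ps as {i} {j} bs j′ refl (i<j′ , j′<j) between =
    no-longer (Linked-insert as bs asc i<j′ j′<j) rc′ (≤-<-trans n≤ps longer)
    where
      rc′ : PlateauRollercoaster k (map W (as ++ i ∷ j′ ∷ j ∷ bs))
      rc′ = subst (PlateauRollercoaster k) (sym (map-++ W as _))
              (insert-rollercoaster (map W as) (map W bs) between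
                (subst (PlateauRollercoaster k) (map-++ W as _) rc))
      longer : length (as ++ i ∷ j ∷ bs) < length (as ++ i ∷ j′ ∷ j ∷ bs)
      longer = ≤-reflexive
        (trans (cong suc (length-++ as)) (trans (sym (+-suc (length as) _)) (sym (length-++ as))))

  no-earlier-copy : ∀ {x y qs} → x Fin.< y → W x ≡ W y → IsPath w (y ∷ qs) →
                    PlateauRollercoaster k (map W (y ∷ qs)) → n ≤ length (y ∷ qs) → ⊥
  no-earlier-copy {qs = qs} x<y wx≡wy path rc n≤ =
    no-longer (x<y ∷ IsPath⇒Linked w path)
      (subst (λ a → PlateauRollercoaster k (a ∷ map W (_ ∷ qs))) (sym wx≡wy)
        (duplicate-rollercoaster [] (map W qs) _ rc))
      (s≤s n≤)

  unique : ∀ {ps qs} → IsPath w ps → IsPath w qs → map W ps ≡ map W qs →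
           PlateauRollercoaster k (map W ps) → n ≤ length ps → ps ≡ qs
  unique {[]}     {[]}     _ _ _ _ _ = refl
  unique {x ∷ ps} {y ∷ qs} P Q spells rc n≤ with ∷-injective spells | Finₚ.<-cmp x y
  ... | _     , rest | tri≈ _ refl _ = cong (x ∷_) (IsPath-determined w P Q rest)
  ... | wx≡wy , _    | tri< x<y _ _ =
    ⊥-elim (no-earlier-copy x<y wx≡wy Q (subst (PlateauRollercoaster k) spells rc)
                                        (≤-trans n≤ (≤-reflexive (map-≡⇒length-≡ W spells))))
  ... | wx≡wy , _    | tri> _ _ y<x = ⊥-elim (no-earlier-copy y<x (sym wx≡wy) P rc n≤)

lemma19 : {σ : ℕ} (k : ℕ) → 3 ≤ k → (w u : Word σ)
          → u ⊆ w → PlateauRollercoaster k u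
          → (∀ (u' : Word σ) → u' ⊆ w → PlateauRollercoaster k u' → length u' ≤ length u)
          → Σ (List (Pos w)) λ p → (IsPath w p × map (lookup w) p ≡ u)
              × (∀ (q : List (Pos w)) → IsPath w q → map (lookup w) q ≡ u → q ≡ p)
lemma19 k _ w u u⊆w rc longest with ⊆⇒positions u⊆w
... | ps , asc , refl = ps , (path , refl) , λ qs Q spells → sym (unique path Q (sym spells) rc n≤)
  where
    open Longest w (length u) longest
    n≤ : length u ≤ length ps
    n≤ = ≤-reflexive (length-map (lookup w) ps)
    path : IsPath w ps
    path = saturated⇒IsPath w asc (saturated asc rc n≤)
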